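{- A term $s$ is reducible at the root position by $\to_{R_2,ACh}$ if and only if $s\downarrow_{R_h,AC}$ is reducible at the root position by $\to_{R_2,AC}$.
   Context: Terms are over $\{+,h,0\}$, variables and free constants. $R_2$ is the rewrite system $x+x\to0$, $x+0\to x$, $x+(y+x)\to y$, $h(0)\to0$. $ACh$ is the theory generated by associativity and commutativity of $+$ and $h(x+y)\approx h(x)+h(y)$; $AC$ is associativity and commutativity of $+$. For a rewrite system $R$ and theory $E$, $t$ is reducible at the root by $\to_{R,E}$ iff $t=_E l\sigma$ for some rule $l\to r\in R$ and substitution $\sigma$. $R_h$ is the rule $h(x+y)\to h(x)+h(y)$ modulo $AC$, and $s\downarrow_{R_h,AC}$ is the normal form of $s$. -}

module Defs where

open import Data.Nat using (ℕ)
open import Data.Product using (Σ; _×_; _,_)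
open import Relation.Nullary using (¬_)
open import Relation.Binary.Construct.Closure.ReflexiveTransitive using (Star)

infixl 6 _⊕_

data Term : Set where
  var  : ℕ → Term
  cst  : ℕ → Term
  𝟘    : Term
  _⊕_  : Term → Term → Term
  h    : Term → Term

Subst : Set
Subst = ℕ → Term

_[_] : Term → Subst → Term
var n   [ σ ] = σ n
cst c   [ σ ] = cst c
𝟘       [ σ ] = 𝟘
(s ⊕ t) [ σ ] = (s [ σ ]) ⊕ (t [ σ ])
h s     [ σ ] = h (s [ σ ])

data Theory : Set where
  AC ACh : Theory

data Axiom : Theory → Term → Term → Set where
  assoc : ∀ {E} x y z → Axiom E ((x ⊕ y) ⊕ z) (x ⊕ (y ⊕ z))
  comm  : ∀ {E} x y → Axiom E (x ⊕ y) (y ⊕ x)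
  hdist : ∀ x y → Axiom ACh (h (x ⊕ y)) (h x ⊕ h y)

data _≈[_]_ : Term → Theory → Term → Set where
  ax     : ∀ {E s t} → Axiom E s t → s ≈[ E ] t
  refl   : ∀ {E s} → s ≈[ E ] s
  sym    : ∀ {E s t} → s ≈[ E ] t → t ≈[ E ] s
  trans  : ∀ {E s t u} → s ≈[ E ] t → t ≈[ E ] u → s ≈[ E ] u
  cong⊕  : ∀ {E s s' t t'} → s ≈[ E ] s' → t ≈[ E ] t' → (s ⊕ t) ≈[ E ] (s' ⊕ t')
  congh  : ∀ {E s s'} → s ≈[ E ] s' → h s ≈[ E ] h s'

RewriteSystem : Set₁
RewriteSystem = Term → Term → Set

x y : Term
x = var 0
y = var 1

data R₂ : RewriteSystem where
  r₁ : R₂ (x ⊕ x) 𝟘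
  r₂ : R₂ (x ⊕ 𝟘) x
  r₃ : R₂ (x ⊕ (y ⊕ x)) y
  r₄ : R₂ (h 𝟘) 𝟘

data Rₕ : RewriteSystem where
  rh : Rₕ (h (x ⊕ y)) (h x ⊕ h y)

RootReducible : RewriteSystem → Theory → Term → Set
RootReducible R E t = Σ Term λ l → Σ Term λ r → R l r × Σ Subst λ σ → t ≈[ E ] (l [ σ ])

data Step (R : RewriteSystem) : Term → Term → Set where
  root : ∀ {l r} (σ : Subst) → R l r → Step R (l [ σ ]) (r [ σ ])
  ⊕ˡ   : ∀ {s s' t} → Step R s s' → Step R (s ⊕ t) (s' ⊕ t)
  ⊕ʳ   : ∀ {s t t'} → Step R t t' → Step R (s ⊕ t) (s ⊕ t')
  hᶜ   : ∀ {s s'} → Step R s s' → Step R (h s) (h s')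

-- Rewriting modulo E (class rewriting): s =_E s' →_R t' =_E t.
StepMod : RewriteSystem → Theory → Term → Term → Set
StepMod R E s t = Σ Term λ s' → Σ Term λ t' →
  (s ≈[ E ] s') × Step R s' t' × (t' ≈[ E ] t)

NormalForm : RewriteSystem → Theory → Term → Set
NormalForm R E t = ¬ (Σ Term λ u → StepMod R E t u)

-- t is a normal form of s w.r.t. →_{R,E}  (t is "s↓_{R,E}", unique up to =_E).
IsNormalFormOf : RewriteSystem → Theory → Term → Term → Set
IsNormalFormOf R E s t = Star (StepMod R E) s t × NormalForm R E t

{-# OPTIONS --safe #-}
module Submission where

-- Every Rₕ-step is an instance of h(x+y) ≈ h(x)+h(y), so s =_ACh t. The multiset of monomials
-- hᵏ(a), a a variable, constant or 0, of a term is invariant under =_ACh, and an Rₕ-normal form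
-- is AC-equal to the sum of its monomials. So if t =_ACh lσ, summing the monomials of lσ along
-- the shape of l (h-free, except for the ground h(0)) gives t =_AC lτ.

open import Defs
open import Function.Base using (_∘_)
open import Function.Bundles using (_⇔_; mk⇔)
open import Data.Nat using (ℕ; zero; suc)
open import Data.Product using (Σ; _×_; _,_)
open import Data.List using (List; []; _∷_; _++_; map)
open import Data.List.Properties using (++-assoc; map-++)
open import Data.List.Relation.Binary.Permutation.Propositional as ↭
  using (_↭_; ↭-refl; ↭-reflexive; ↭-sym; ↭-trans)
open import Data.List.Relation.Binary.Permutation.Propositional.Properties
  using (++-comm; ++⁺; map⁺; ↭-empty-inv)
open import Data.Unit using (⊤)
open import Data.Empty using (⊥; ⊥-elim)
open import Relation.Nullary using (¬_)
open import Relation.Binary.Bundles using (Setoid)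
open import Relation.Binary.PropositionalEquality as ≡ using (_≡_)
open import Relation.Binary.Construct.Closure.ReflexiveTransitive using (Star; ε; _◅_)
import Relation.Binary.Reasoning.Setoid as SetoidReasoning

≈-setoid : Theory → Setoid _ _
≈-setoid E = record
  { Carrier = Term
  ; _≈_ = _≈[ E ]_
  ; isEquivalence = record { refl = refl ; sym = sym ; trans = trans }
  }

module ≈-Reasoning (E : Theory) = SetoidReasoning (≈-setoid E)

≈[AC]⇒≈ : ∀ {E s t} → s ≈[ AC ] t → s ≈[ E ] t
≈[AC]⇒≈ (ax (assoc a b c)) = ax (assoc a b c)
≈[AC]⇒≈ (ax (comm a b))    = ax (comm a b)
≈[AC]⇒≈ refl               = refl
≈[AC]⇒≈ (sym p)            = sym (≈[AC]⇒≈ p)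
≈[AC]⇒≈ (trans p q)        = trans (≈[AC]⇒≈ p) (≈[AC]⇒≈ q)
≈[AC]⇒≈ (cong⊕ p q)        = cong⊕ (≈[AC]⇒≈ p) (≈[AC]⇒≈ q)
≈[AC]⇒≈ (congh p)          = congh (≈[AC]⇒≈ p)

rootReducible-resp-≈ : ∀ {R E s t} → s ≈[ E ] t → RootReducible R E s → RootReducible R E t
rootReducible-resp-≈ s≈t (l , r , ρ , σ , s≈lσ) = l , r , ρ , σ , trans (sym s≈t) s≈lσ

rootReducible-AC⇒ : ∀ {R E t} → RootReducible R AC t → RootReducible R E t
rootReducible-AC⇒ (l , r , ρ , σ , t≈lσ) = l , r , ρ , σ , ≈[AC]⇒≈ t≈lσ

Rₕ-step-sound : ∀ {s t} → Step Rₕ s t → s ≈[ ACh ] t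
Rₕ-step-sound (root σ rh) = ax (hdist _ _)
Rₕ-step-sound (⊕ˡ p)      = cong⊕ (Rₕ-step-sound p) refl
Rₕ-step-sound (⊕ʳ p)      = cong⊕ refl (Rₕ-step-sound p)
Rₕ-step-sound (hᶜ p)      = congh (Rₕ-step-sound p)

Rₕ-AC-rewriting-sound : ∀ {s t} → Star (StepMod Rₕ AC) s t → s ≈[ ACh ] t
Rₕ-AC-rewriting-sound ε = refl
Rₕ-AC-rewriting-sound ((_ , _ , s≈s′ , s′→t′ , t′≈u) ◅ u↠t) =
  trans (≈[AC]⇒≈ s≈s′) (trans (Rₕ-step-sound s′→t′)
    (trans (≈[AC]⇒≈ t′≈u) (Rₕ-AC-rewriting-sound u↠t)))

data Atom : Set where
  varᵃ cstᵃ : ℕ → Atom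
  𝟘ᵃ : Atom

atom : Atom → Term
atom (varᵃ n) = var n
atom (cstᵃ c) = cst c
atom 𝟘ᵃ       = 𝟘

hⁿ : ℕ → Term → Term
hⁿ zero    t = t
hⁿ (suc k) t = h (hⁿ k t)

Monomial : Set
Monomial = ℕ × Atom

⟦_⟧ᵐ : Monomial → Term
⟦ k , a ⟧ᵐ = hⁿ k (atom a)

h-monomial : Monomial → Monomial
h-monomial (k , a) = suc k , a

monomials : Term → List Monomial
monomials (var n) = (0 , varᵃ n) ∷ []
monomials (cst c) = (0 , cstᵃ c) ∷ []
monomials 𝟘       = (0 , 𝟘ᵃ) ∷ []
monomials (s ⊕ t) = monomials s ++ monomials t
monomials (h s)   = map h-monomial (monomials s)

-- ∑ [] = 𝟘 is a junk value (+ has no unit modulo AC); lists of monomials of terms are never empty.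
∑ : List Monomial → Term
∑ []           = 𝟘
∑ (m ∷ [])     = ⟦ m ⟧ᵐ
∑ (m ∷ n ∷ ms) = ⟦ m ⟧ᵐ ⊕ ∑ (n ∷ ms)

normalise : Term → Term
normalise = ∑ ∘ monomials

monomials-resp-≈ : ∀ {E s t} → s ≈[ E ] t → monomials s ↭ monomials t
monomials-resp-≈ (ax (assoc a b c)) = ↭-reflexive (++-assoc (monomials a) (monomials b) (monomials c))
monomials-resp-≈ (ax (comm a b))    = ++-comm (monomials a) (monomials b)
monomials-resp-≈ (ax (hdist a b))   = ↭-reflexive (map-++ h-monomial (monomials a) (monomials b))
monomials-resp-≈ refl               = ↭-refl
monomials-resp-≈ (sym p)            = ↭-sym (monomials-resp-≈ p)
monomials-resp-≈ (trans p q)        = ↭-trans (monomials-resp-≈ p) (monomials-resp-≈ q)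
monomials-resp-≈ (cong⊕ p q)        = ++⁺ (monomials-resp-≈ p) (monomials-resp-≈ q)
monomials-resp-≈ (congh p)          = map⁺ h-monomial (monomials-resp-≈ p)

NonEmpty : List Monomial → Set
NonEmpty []      = ⊥
NonEmpty (_ ∷ _) = ⊤

monomials-nonEmpty : ∀ s → NonEmpty (monomials s)
monomials-nonEmpty (var n) = _
monomials-nonEmpty (cst c) = _
monomials-nonEmpty 𝟘       = _
monomials-nonEmpty (s ⊕ t) with monomials s | monomials-nonEmpty s
... | _ ∷ _ | _ = _
monomials-nonEmpty (h s) with monomials s | monomials-nonEmpty s
... | _ ∷ _ | _ = _

∑-++ : ∀ {E} A B → NonEmpty A → NonEmpty B → ∑ (A ++ B) ≈[ E ] (∑ A ⊕ ∑ B)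
∑-++ (a ∷ [])     (b ∷ B) _ _ = refl
∑-++ (a ∷ a′ ∷ A) (b ∷ B) _ _ =
  trans (cong⊕ refl (∑-++ (a′ ∷ A) (b ∷ B) _ _)) (sym (ax (assoc _ _ _)))

∑-resp-↭ : ∀ {E A B} → A ↭ B → ∑ A ≈[ E ] ∑ B
∑-resp-↭ ↭.refl = refl
∑-resp-↭ (↭.prep {xs = []} _ p) with ↭-empty-inv (↭-sym p)
... | ≡.refl = refl
∑-resp-↭ (↭.prep {xs = _ ∷ _} {ys = []} _ p) with () ← ↭-empty-inv p
∑-resp-↭ (↭.prep {xs = _ ∷ _} {ys = _ ∷ _} _ p) = cong⊕ refl (∑-resp-↭ p)
∑-resp-↭ (↭.swap {xs = []} _ _ p) with ↭-empty-inv (↭-sym p)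
... | ≡.refl = ax (comm _ _)
∑-resp-↭ (↭.swap {xs = _ ∷ _} {ys = []} _ _ p) with () ← ↭-empty-inv p
∑-resp-↭ {E} (↭.swap {xs = _ ∷ _} {ys = _ ∷ _} a b p) = begin
  ⟦ a ⟧ᵐ ⊕ (⟦ b ⟧ᵐ ⊕ _) ≈⟨ ax (assoc _ _ _) ⟨
  (⟦ a ⟧ᵐ ⊕ ⟦ b ⟧ᵐ) ⊕ _ ≈⟨ cong⊕ (ax (comm _ _)) (∑-resp-↭ p) ⟩
  (⟦ b ⟧ᵐ ⊕ ⟦ a ⟧ᵐ) ⊕ _ ≈⟨ ax (assoc _ _ _) ⟩
  ⟦ b ⟧ᵐ ⊕ (⟦ a ⟧ᵐ ⊕ _) ∎
  where open ≈-Reasoning E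
∑-resp-↭ (↭.trans p q) = trans (∑-resp-↭ p) (∑-resp-↭ q)

normalise-resp-≈ : ∀ {E s t} → s ≈[ ACh ] t → normalise s ≈[ E ] normalise t
normalise-resp-≈ = ∑-resp-↭ ∘ monomials-resp-≈

data Distributed : Term → Set where
  monomial : ∀ m → Distributed ⟦ m ⟧ᵐ
  _⊕_      : ∀ {s t} → Distributed s → Distributed t → Distributed (s ⊕ t)

monomials-⟦⟧ : ∀ m → monomials ⟦ m ⟧ᵐ ≡ m ∷ []
monomials-⟦⟧ (zero , varᵃ n) = ≡.refl
monomials-⟦⟧ (zero , cstᵃ c) = ≡.refl
monomials-⟦⟧ (zero , 𝟘ᵃ)     = ≡.refl
monomials-⟦⟧ (suc k , a)     = ≡.cong (map h-monomial) (monomials-⟦⟧ (k , a))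

normalise-distributed : ∀ {E t} → Distributed t → normalise t ≈[ E ] t
normalise-distributed (monomial m) rewrite monomials-⟦⟧ m = refl
normalise-distributed (_⊕_ {s} {t} ds dt) =
  trans (∑-++ (monomials s) (monomials t) (monomials-nonEmpty s) (monomials-nonEmpty t))
        (cong⊕ (normalise-distributed ds) (normalise-distributed dt))

Rₕ-Irreducible : Term → Set
Rₕ-Irreducible t = ∀ u → ¬ Step Rₕ t u

Rₕ-irreducible⇒distributed : ∀ t → Rₕ-Irreducible t → Distributed t
Rₕ-irreducible⇒distributed (var n) _ = monomial (0 , varᵃ n)
Rₕ-irreducible⇒distributed (cst c) _ = monomial (0 , cstᵃ c)
Rₕ-irreducible⇒distributed 𝟘       _ = monomial (0 , 𝟘ᵃ)
Rₕ-irreducible⇒distributed (s ⊕ t) irr =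
  Rₕ-irreducible⇒distributed s (λ _ → irr _ ∘ ⊕ˡ) ⊕ Rₕ-irreducible⇒distributed t (λ _ → irr _ ∘ ⊕ʳ)
Rₕ-irreducible⇒distributed (h s) irr with Rₕ-irreducible⇒distributed s (λ _ → irr _ ∘ hᶜ)
... | monomial m = monomial (h-monomial m)
... | _⊕_ {a} {b} _ _ = ⊥-elim (irr _ (root (λ { 0 → a ; _ → b }) rh))

data HFree : Term → Set where
  var : ∀ n → HFree (var n)
  cst : ∀ c → HFree (cst c)
  𝟘   : HFree 𝟘
  _⊕_ : ∀ {s t} → HFree s → HFree t → HFree (s ⊕ t)

normalise-subst : ∀ {E l} (σ : Subst) → HFree l → normalise (l [ σ ]) ≈[ E ] (l [ normalise ∘ σ ])
normalise-subst σ (var n) = refl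
normalise-subst σ (cst c) = refl
normalise-subst σ 𝟘       = refl
normalise-subst σ (_⊕_ {s} {t} fs ft) =
  trans (∑-++ (monomials (s [ σ ])) (monomials (t [ σ ]))
              (monomials-nonEmpty (s [ σ ])) (monomials-nonEmpty (t [ σ ])))
        (cong⊕ (normalise-subst σ fs) (normalise-subst σ ft))

-- h(0) → 0 is the only rule of R₂ whose left-hand side contains h, and it is ground.
R₂-normalise-instance : ∀ {E l r} → R₂ l r → (σ : Subst) → Σ Subst λ τ → normalise (l [ σ ]) ≈[ E ] (l [ τ ])
R₂-normalise-instance r₁ σ = normalise ∘ σ , normalise-subst σ (var 0 ⊕ var 0)
R₂-normalise-instance r₂ σ = normalise ∘ σ , normalise-subst σ (var 0 ⊕ 𝟘)
R₂-normalise-instance r₃ σ = normalise ∘ σ , normalise-subst σ (var 0 ⊕ (var 1 ⊕ var 0))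
R₂-normalise-instance r₄ σ = σ , refl

distributed-rootReducible-ACh⇒AC : ∀ {t} → Distributed t → RootReducible R₂ ACh t → RootReducible R₂ AC t
distributed-rootReducible-ACh⇒AC {t} dt (l , r , ρ , σ , t≈lσ) with R₂-normalise-instance ρ σ
... | τ , lσ≈lτ = l , r , ρ , τ , (begin
  t             ≈⟨ normalise-distributed dt ⟨
  normalise t   ≈⟨ normalise-resp-≈ t≈lσ ⟩
  normalise (l [ σ ]) ≈⟨ lσ≈lτ ⟩
  l [ τ ]       ∎)
  where open ≈-Reasoning AC

mainTheorem11 : ∀ (s t : Term) → IsNormalFormOf Rₕ AC s t →
    (RootReducible R₂ ACh s ⇔ RootReducible R₂ AC t)
mainTheorem11 s t (s↠t , t-nf) = mk⇔
  (distributed-rootReducible-ACh⇒AC t-distributed ∘ rootReducible-resp-≈ s≈t)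
  (rootReducible-resp-≈ (sym s≈t) ∘ rootReducible-AC⇒)
  where
  s≈t : s ≈[ ACh ] t
  s≈t = Rₕ-AC-rewriting-sound s↠t
  t-distributed : Distributed t
  t-distributed = Rₕ-irreducible⇒distributed t (λ u t→u → t-nf (u , t , u , refl , t→u , refl))
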